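{- If $2^{a_1}3^{a_2}5^{a_3}\cdots$ is a reduced integer, then $a_2\ge a_3\ge a_4\ge\cdots$.
   Context: Let $p_i$ denote the $i$-th prime ($p_1=2$). A positive integer $2^{a_1}3^{a_2}5^{a_3}\cdots=\prod_i p_i^{a_i}$ (with $a_i=0$ for all sufficiently large $i$) is called reduced if $\left\lfloor\frac{a_i+1}{a_j+2}\right\rfloor<\frac{\log p_j}{\log p_i}$ whenever $i,j\ne1$, and $2^{a_1}<8p_j^2$ whenever $a_j=0$. -}

module Defs where

open import Data.Nat using (ℕ; zero; suc; _+_; _*_; _^_; _≤_; _<_; _!)
open import Data.Nat.DivMod using (_/_)
open import Data.Nat.Primality using (prime?)
open import Data.Product using (∃-syntax; _×_)
open import Relation.Binary.PropositionalEquality using (_≡_)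
open import Relation.Nullary using (yes; no)

-- Smallest prime in [s, s+f), or s+f if there is none (fuel-bounded search).
searchPrime : (fuel start : ℕ) → ℕ
searchPrime zero    s = s
searchPrime (suc f) s with prime? s
... | yes _ = s
... | no  _ = searchPrime f (suc s)

-- The least prime > p (for p ≥ 1 there is a prime in (p, p! + 1], which the search covers).
nextPrime : ℕ → ℕ
nextPrime p = searchPrime (p !) (suc p)

-- 0-indexed: nthPrime 0 = 2 = p_1, nthPrime 1 = 3 = p_2, ...  (nthPrime i = p_{i+1})
nthPrime : ℕ → ℕ
nthPrime zero    = 2
nthPrime (suc n) = nextPrime (nthPrime n)

-- Exponent sequence a, 0-indexed: a i is the exponent of nthPrime i (= a_{i+1} in the paper).
-- Finite support: a i = 0 for all sufficiently large i.
FiniteSupport : (ℕ → ℕ) → Set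
FiniteSupport a = ∃[ N ] (∀ i → N ≤ i → a i ≡ 0)

-- Reduced (paper indices i,j ≠ 1 become 0-indexed i,j ≥ 1).
-- floor((a_i+1)/(a_j+2)) < log p_j / log p_i  is written as  p_i ^ floor(...) < p_j
-- (a_j + 2 is written suc (suc (a j)) so the NonZero instance is found.)
-- (equivalent since log p_i > 0 and log is strictly increasing; no reals in stdlib).
Reduced : (ℕ → ℕ) → Set
Reduced a =
  (∀ i j → 1 ≤ i → 1 ≤ j →
     nthPrime i ^ ((a i + 1) / suc (suc (a j))) < nthPrime j)
  × (∀ j → a j ≡ 0 → 2 ^ a 0 < 8 * (nthPrime j ^ 2))

module Submission where

open import Defs
open import Data.Nat using (ℕ; zero; suc; _≤_; _<_; _>_; _+_; _^_; _!; NonZero; >-nonZero; z≤n; s≤s; s≤s⁻¹)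
open import Data.Nat.Properties
open import Data.Nat.DivMod using (_/_; m/n≡0⇒m<n)
open import Data.Nat.Primality using (prime?)
open import Data.Product using (_,_)
open import Relation.Nullary using (yes; no; contradiction)
open import Relation.Binary.PropositionalEquality using (_≡_; refl; subst)

-- The reduced condition with i = j + 1 says p_{j+1} ^ ⌊(a_{j+1}+1)/(a_j+2)⌋ < p_j;
-- as p_j < p_{j+1}, the exponent must vanish, i.e. a_{j+1} + 1 < a_j + 2.

≤-searchPrime : ∀ fuel s → s ≤ searchPrime fuel s
≤-searchPrime zero    s = ≤-refl
≤-searchPrime (suc f) s with prime? s
... | yes _ = ≤-refl
... | no  _ = ≤-trans (n≤1+n s) (≤-searchPrime f (suc s))

nthPrime-<-suc : ∀ i → nthPrime i < nthPrime (suc i)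
nthPrime-<-suc i = ≤-searchPrime (nthPrime i !) (suc (nthPrime i))

nthPrime>0 : ∀ i → nthPrime i > 0
nthPrime>0 zero    = s≤s z≤n
nthPrime>0 (suc i) = <-trans (nthPrime>0 i) (nthPrime-<-suc i)

m^n<o≤m⇒n≡0 : ∀ m n {o} .{{_ : NonZero m}} → m ^ n < o → o ≤ m → n ≡ 0
m^n<o≤m⇒n≡0 m zero          _     _   = refl
m^n<o≤m⇒n≡0 m (suc n) {o} m^n<o o≤m = contradiction m^n<o (≤⇒≯ (begin
  o           ≤⟨ o≤m ⟩
  m           ≡⟨ ^-identityʳ m ⟨
  m ^ 1       ≤⟨ ^-monoʳ-≤ m (s≤s (z≤n {n})) ⟩
  m ^ suc n   ∎))
  where open ≤-Reasoning

m+1<n+2⇒m≤n : ∀ {m n} → m + 1 < suc (suc n) → m ≤ n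
m+1<n+2⇒m≤n {m} {n} lt = s≤s⁻¹ (subst (_≤ suc n) (+-comm m 1) (s≤s⁻¹ lt))

lemma3p11 : (a : ℕ → ℕ) → FiniteSupport a → Reduced a →
    ∀ i → 1 ≤ i → a (suc i) ≤ a i
lemma3p11 a _ (exponentBound , _) i 1≤i =
  m+1<n+2⇒m≤n (m/n≡0⇒m<n floor≡0)
  where
  instance
    p-nonZero : NonZero (nthPrime (suc i))
    p-nonZero = >-nonZero (nthPrime>0 (suc i))

  floor≡0 : (a (suc i) + 1) / suc (suc (a i)) ≡ 0
  floor≡0 = m^n<o≤m⇒n≡0 (nthPrime (suc i)) ((a (suc i) + 1) / suc (suc (a i)))
    (exponentBound (suc i) i (s≤s z≤n) 1≤i) (<⇒≤ (nthPrime-<-suc i))
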